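{- Let $p>3$ be a prime, $k$ an integer with $0\le k\le p-1$ and $k\neq3$, $e\ge1$, and $l_1,l_2,l_3$ non-negative integers. Assume that $\frac{3k}{2(k-3)}\in\mathbb{F}_p$ is a quadratic non-residue of $p$. Then $D_{p^{l_1}+p^{l_2}+p^{l_3},k}(1,x)$ is a permutation polynomial of $\mathbb{F}_{p^e}$ if and only if \[k\,x^{\frac{p^{l_1}+p^{l_2}+p^{l_3}-1}{2}}+(2-k)\Big[x^{\frac{p^{l_1}+p^{l_2}}{2}}+x^{\frac{p^{l_1}+p^{l_3}}{2}}+x^{\frac{p^{l_2}+p^{l_3}}{2}}\Big]+k\Big[x^{\frac{p^{l_1}-1}{2}}+x^{\frac{p^{l_2}-1}{2}}+x^{\frac{p^{l_3}-1}{2}}\Big]\] is a permutation polynomial of $\mathbb{F}_{p^e}$.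
   Context: For an odd prime $p$ and $0\le k\le p-1$: for $n\ge 1$, $D_{n,k}(1,x)=\sum_{i=0}^{\lfloor n/2\rfloor}\frac{n-ki}{n-i}\binom{n-i}{i}(-x)^i$, where the coefficient is the integer $\binom{n-i}{i}-(k-1)\binom{n-i-1}{i-1}$ (with $\binom{m}{ -1}=0$) viewed in $\mathbb{F}_p$; $D_{0,k}(1,x)=2-k$. Equivalently $D_{1,k}=1$ and $D_{n,k}=D_{n-1,k}-xD_{n-2,k}$ for $n\ge2$. A polynomial over $\mathbb{F}_q$ is a permutation polynomial of $\mathbb{F}_q$ if it induces a bijection of $\mathbb{F}_q$. A nonzero $c\in\mathbb{F}_p$ is a quadratic non-residue of $p$ if it is not a square in $\mathbb{F}_p$. Here $x^0$ means $1$. -}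

module Defs where

open import Level using (0ℓ)
open import Data.Nat using (ℕ; zero; suc; _∸_; _/_) renaming (_+_ to _+ℕ_; _*_ to _*ℕ_; _^_ to _^ℕ_)
open import Data.Integer using (ℤ; +_; -[1+_]) renaming (_*_ to _*ℤ_; _-_ to _-ℤ_)
open import Data.Integer.Divisibility using () renaming (_∣_ to _∣ℤ_)
open import Data.Fin using (Fin)
open import Data.Product using (Σ; ∃; _×_)
open import Relation.Nullary using (¬_)
open import Relation.Binary.PropositionalEquality using (_≡_; _≢_)
open import Algebra.Structures using (IsCommutativeRing)
open import Function.Bundles using (_↔_)
open import Function.Definitions using (Bijective)

record Field : Set₁ where
  infixl 6 _+_
  infixl 7 _*_
  field
    Carrier : Set
    _+_ _*_ : Carrier → Carrier → Carrier
    -_ : Carrier → Carrier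
    0# 1# : Carrier
    isCommutativeRing : IsCommutativeRing _≡_ _+_ _*_ -_ 0# 1#
    0≢1 : 0# ≢ 1#
    inverse : ∀ x → x ≢ 0# → Σ Carrier (λ y → x * y ≡ 1#)

  _-_ : Carrier → Carrier → Carrier
  x - y = x + (- y)

  fromℕ : ℕ → Carrier
  fromℕ zero = 0#
  fromℕ (suc n) = 1# + fromℕ n

  fromℤ : ℤ → Carrier
  fromℤ (+ n) = fromℕ n
  fromℤ -[1+ n ] = - fromℕ (suc n)

  infixr 8 _^_
  _^_ : Carrier → ℕ → Carrier
  x ^ zero = 1#
  x ^ suc n = x * (x ^ n)

open Field public using (Carrier)

HasOrder : Field → ℕ → Set
HasOrder F q = Carrier F ↔ Fin q

IsPermutation : (F : Field) → (Carrier F → Carrier F) → Set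
IsPermutation F f = Bijective _≡_ _≡_ f

-- Evaluation at x of D_{n,k}(1,x) (coefficients in ℤ, hence in F_p ⊆ F),
-- via D_{0,k} = 2-k, D_{1,k} = 1, D_{n,k} = D_{n-1,k} - x D_{n-2,k}.
Dickson : (F : Field) → ℕ → ℕ → Carrier F → Carrier F
Dickson F zero k x = Field.fromℤ F (+ 2 -ℤ + k)
Dickson F (suc zero) k x = Field.1# F
Dickson F (suc (suc n)) k x =
  Field._-_ F (Dickson F (suc n) k x) (Field._*_ F x (Dickson F n k x))

-- c / d (d invertible mod p) is a quadratic non-residue of p:
-- c/d ≢ 0 mod p and there is no y with y² ≡ c/d, i.e. y² d ≡ c (mod p).
QNRQuot : ℕ → ℤ → ℤ → Set
QNRQuot p c d = ¬ ((+ p) ∣ℤ c) × ¬ (∃ λ (y : ℤ) → (+ p) ∣ℤ (y *ℤ y *ℤ d -ℤ c))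

RHSPoly : (F : Field) → ℕ → ℕ → ℕ → ℕ → ℕ → Carrier F → Carrier F
RHSPoly F p k l₁ l₂ l₃ x =
  let open Field F using (_+_; _*_; _^_; fromℕ; fromℤ) in
  let a = p ^ℕ l₁ ; b = p ^ℕ l₂ ; c = p ^ℕ l₃ in
  (fromℕ k * (x ^ (((a +ℕ b +ℕ c) ∸ 1) / 2)))
  + (fromℤ (+ 2 -ℤ + k) * ((x ^ ((a +ℕ b) / 2)) + (x ^ ((a +ℕ c) / 2)) + (x ^ ((b +ℕ c) / 2))))
  + (fromℕ k * ((x ^ ((a ∸ 1) / 2)) + (x ^ ((b ∸ 1) / 2)) + (x ^ ((c ∸ 1) / 2))))

module Submission where

-- Let p > 3 be prime, F a field with p^e elements, h = 1/2 ∈ F, and for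
-- x ∈ F put Δ = 1 - 4x.  In the ring F[√Δ] (pairs a + b√Δ; Δ need not be
-- a non-square) the element Y = (1 + √Δ)/2 is a root of T² - T + x, so
-- the Dickson values are D_{n,k}(1,x) = L(Yⁿ) for the F-linear map
-- L(a + b√Δ) = (2-k) a + k b.  Since F[√Δ] has characteristic p, the
-- Frobenius identity gives Y^(pˡ) = (1 + Δ^((pˡ-1)/2) √Δ)/2, and multiplying
-- three such factors yields the closed form
--     D_{p^l₁+p^l₂+p^l₃,k}(1,x) = (1/8) ((2-k) + R(1 - 4x)),
-- R being the second polynomial of the theorem.  Thus D = g ∘ R ∘ f for
-- the affine bijections f x = 1 - 4x and g t = (1/8)(2 - k + t), and D
-- permutes F exactly when R does.  This holds for every k.

open import Defs hiding (Carrier)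
open import Level using (0ℓ)
open import Data.Nat as ℕ using (ℕ; zero; suc; _<_; _∸_; _!; s≤s; z≤n)
import Data.Nat.Properties as ℕP
open import Data.Nat.Divisibility using (_∣_; divides; ∣⇒≤; m∣m*n)
open import Data.Nat.Primality using (Prime; euclidsLemma; prime⇒nonZero; prime⇒nonTrivial; prime⇒irreducible)
open import Data.Nat.Combinatorics using (nCn≡1; k![n∸k]!∣n!) renaming (_C_ to _choose_)
open import Data.Nat.Combinatorics.Specification using (nCk≡n!/k![n-k]!)
open import Data.Nat.DivMod using (m/n*n≡m)
open import Data.Integer as ℤ using (ℤ; -[1+_]; _⊖_) renaming (+_ to pos)
import Data.Integer.Properties as ℤP
open import Data.Sign as Sign using (Sign)
open import Data.Fin as Fin using (Fin; toℕ; inject₁)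
import Data.Fin.Properties as FinP
import Data.Fin.Permutation as Perm
open import Data.Maybe using (Maybe; just; nothing)
open import Data.Product using (_,_; proj₁; proj₂; ∃)
open import Data.Sum using (_⊎_; inj₁; inj₂)
open import Data.Empty using (⊥-elim)
open import Relation.Nullary using (¬_; yes; no; contradiction)
open import Relation.Binary.Definitions using (DecidableEquality)
import Relation.Binary.PropositionalEquality as ≡
open ≡ using (_≡_; _≢_; refl; sym; trans; cong; cong₂; subst; isEquivalence; module ≡-Reasoning)
open import Function.Base using (_∘_)
open import Function.Bundles using (Inverse; _↔_; _⇔_; mk⇔; mk↔ₛ′; Bijection)
open import Function.Definitions using (Bijective)
open import Function.Properties.Inverse using (↔⇒⤖)
open import Function.Consequences.Propositional
  using (surjective⇒strictlySurjective; strictlySurjective⇒surjective)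
open import Algebra.Bundles using (CommutativeRing; CommutativeSemiring)
open import Algebra.Structures using (IsCommutativeSemiring)
import Algebra.Solver.Ring
import Algebra.Solver.Ring.AlmostCommutativeRing as ACR

module FieldArithmetic (F : Field) where
  open Field F public
  open ≡-Reasoning

  commutativeRing : CommutativeRing 0ℓ 0ℓ
  commutativeRing = record { isCommutativeRing = isCommutativeRing }

  open CommutativeRing commutativeRing public
    using ( +-assoc; +-comm; +-identityˡ; +-identityʳ; -‿inverseˡ; -‿inverseʳ
          ; *-assoc; *-comm; *-identityˡ; *-identityʳ; distribʳ; zeroˡ; zeroʳ
          ; ring; semiring; commutativeSemiring )
  open import Algebra.Properties.Ring ring public
    using (-‿distribˡ-*; -‿involutive; -0#≈0#; -‿+-comm)
  open CommutativeRing commutativeRing using (*-commutativeSemigroup)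
  open import Algebra.Properties.CommutativeSemigroup *-commutativeSemigroup
    using () renaming (interchange to *-interchange)

  fromℕ-+ : ∀ m n → fromℕ (m ℕ.+ n) ≡ fromℕ m + fromℕ n
  fromℕ-+ zero    n = sym (+-identityˡ _)
  fromℕ-+ (suc m) n = trans (cong (1# +_) (fromℕ-+ m n)) (sym (+-assoc _ _ _))

  fromℕ-* : ∀ m n → fromℕ (m ℕ.* n) ≡ fromℕ m * fromℕ n
  fromℕ-* zero    n = sym (zeroˡ _)
  fromℕ-* (suc m) n = begin
    fromℕ (n ℕ.+ m ℕ.* n)           ≡⟨ fromℕ-+ n (m ℕ.* n) ⟩
    fromℕ n + fromℕ (m ℕ.* n)       ≡⟨ cong₂ _+_ (sym (*-identityˡ _)) (fromℕ-* m n) ⟩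
    1# * fromℕ n + fromℕ m * fromℕ n ≡⟨ sym (distribʳ _ _ _) ⟩
    (1# + fromℕ m) * fromℕ n        ∎

  -- a - b = (1 + a) - (1 + b), the recursion step of _⊖_.
  sub-shift : ∀ a b → a - b ≡ (1# + a) - (1# + b)
  sub-shift a b = begin
    a - b                       ≡⟨ sym (+-identityˡ _) ⟩
    0# + (a - b)                ≡⟨ cong (_+ (a - b)) (sym (-‿inverseʳ 1#)) ⟩
    (1# - 1#) + (a - b)         ≡⟨ +-assoc _ _ _ ⟩
    1# + (- 1# + (a - b))       ≡⟨ cong (1# +_) (sym (+-assoc _ _ _)) ⟩
    1# + ((- 1# + a) + - b)     ≡⟨ cong (λ z → 1# + (z + - b)) (+-comm _ _) ⟩
    1# + ((a + - 1#) + - b)     ≡⟨ cong (1# +_) (+-assoc _ _ _) ⟩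
    1# + (a + (- 1# + - b))     ≡⟨ sym (+-assoc _ _ _) ⟩
    (1# + a) + (- 1# + - b)     ≡⟨ cong ((1# + a) +_) (-‿+-comm 1# b) ⟩
    (1# + a) - (1# + b)         ∎

  fromℤ-⊖ : ∀ m n → fromℤ (m ⊖ n) ≡ fromℕ m - fromℕ n
  fromℤ-⊖ m       zero    = sym (trans (cong (fromℕ m +_) -0#≈0#) (+-identityʳ _))
  fromℤ-⊖ zero    (suc n) = sym (+-identityˡ _)
  fromℤ-⊖ (suc m) (suc n) = begin
    fromℤ (suc m ⊖ suc n)   ≡⟨ cong fromℤ (ℤP.[1+m]⊖[1+n]≡m⊖n m n) ⟩
    fromℤ (m ⊖ n)           ≡⟨ fromℤ-⊖ m n ⟩
    fromℕ m - fromℕ n       ≡⟨ sub-shift _ _ ⟩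
    fromℕ (suc m) - fromℕ (suc n) ∎

  fromℤ-+ : ∀ i j → fromℤ (i ℤ.+ j) ≡ fromℤ i + fromℤ j
  fromℤ-+ -[1+ m ] -[1+ n ] = begin
    - (1# + (1# + fromℕ (m ℕ.+ n)))       ≡⟨ cong (λ z → - (1# + (1# + z))) (fromℕ-+ m n) ⟩
    - (1# + (1# + (fromℕ m + fromℕ n)))   ≡⟨ cong (λ z → - (1# + z)) (sym (+-assoc _ _ _)) ⟩
    - (1# + ((1# + fromℕ m) + fromℕ n))   ≡⟨ cong (λ z → - (1# + z)) (+-comm _ _) ⟩
    - (1# + (fromℕ n + (1# + fromℕ m)))   ≡⟨ cong -_ (sym (+-assoc _ _ _)) ⟩
    - ((1# + fromℕ n) + (1# + fromℕ m))   ≡⟨ cong -_ (+-comm _ _) ⟩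
    - ((1# + fromℕ m) + (1# + fromℕ n))   ≡⟨ sym (-‿+-comm _ _) ⟩
    - (1# + fromℕ m) + - (1# + fromℕ n)   ∎
  fromℤ-+ -[1+ m ] (pos n)  = trans (fromℤ-⊖ n (suc m)) (+-comm _ _)
  fromℤ-+ (pos m)  -[1+ n ] = fromℤ-⊖ m (suc n)
  fromℤ-+ (pos m)  (pos n)  = fromℕ-+ m n

  fromℤ-neg : ∀ i → fromℤ (ℤ.- i) ≡ - fromℤ i
  fromℤ-neg -[1+ n ]    = sym (-‿involutive _)
  fromℤ-neg (pos zero)    = sym -0#≈0#
  fromℤ-neg (pos (suc n)) = refl

  -- Multiplicativity goes through the sign/absolute-value decomposition
  -- i = sign i ◃ ∣ i ∣ used in the definition of integer multiplication.
  fromSign : Sign → Carrier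
  fromSign Sign.+ = 1#
  fromSign Sign.- = - 1#

  fromSign-* : ∀ s t → fromSign (s Sign.* t) ≡ fromSign s * fromSign t
  fromSign-* Sign.+ t      = sym (*-identityˡ _)
  fromSign-* Sign.- Sign.+ = sym (*-identityʳ _)
  fromSign-* Sign.- Sign.- = begin
    1#             ≡⟨ sym (-‿involutive _) ⟩
    - - 1#         ≡⟨ cong -_ (sym (*-identityˡ _)) ⟩
    - (1# * - 1#)  ≡⟨ -‿distribˡ-* _ _ ⟩
    - 1# * - 1#    ∎

  fromℤ-◃ : ∀ s n → fromℤ (s ℤ.◃ n) ≡ fromSign s * fromℕ n
  fromℤ-◃ s      zero    = sym (zeroʳ _)
  fromℤ-◃ Sign.+ (suc n) = sym (*-identityˡ _)
  fromℤ-◃ Sign.- (suc n) = sym (trans (sym (-‿distribˡ-* _ _)) (cong -_ (*-identityˡ _)))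

  fromℤ-sign-abs : ∀ i → fromℤ i ≡ fromSign (ℤ.sign i) * fromℕ ℤ.∣ i ∣
  fromℤ-sign-abs i = trans (cong fromℤ (sym (ℤP.◃-inverse i))) (fromℤ-◃ (ℤ.sign i) ℤ.∣ i ∣)

  fromℤ-* : ∀ i j → fromℤ (i ℤ.* j) ≡ fromℤ i * fromℤ j
  fromℤ-* i j = begin
    fromℤ (i ℤ.* j)
      ≡⟨ fromℤ-◃ (ℤ.sign i Sign.* ℤ.sign j) (ℤ.∣ i ∣ ℕ.* ℤ.∣ j ∣) ⟩
    fromSign (ℤ.sign i Sign.* ℤ.sign j) * fromℕ (ℤ.∣ i ∣ ℕ.* ℤ.∣ j ∣)
      ≡⟨ cong₂ _*_ (fromSign-* (ℤ.sign i) (ℤ.sign j)) (fromℕ-* ℤ.∣ i ∣ ℤ.∣ j ∣) ⟩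
    (fromSign (ℤ.sign i) * fromSign (ℤ.sign j)) * (fromℕ ℤ.∣ i ∣ * fromℕ ℤ.∣ j ∣)
      ≡⟨ *-interchange _ _ _ _ ⟩
    (fromSign (ℤ.sign i) * fromℕ ℤ.∣ i ∣) * (fromSign (ℤ.sign j) * fromℕ ℤ.∣ j ∣)
      ≡⟨ sym (cong₂ _*_ (fromℤ-sign-abs i) (fromℤ-sign-abs j)) ⟩
    fromℤ i * fromℤ j ∎

  -- The ring solver for F with integer coefficients.  The interpretation
  -- agrees with fromℤ but sends 0 and 1 to 0# and 1# on the nose.
  ⟦_⟧ℤ : ℤ → Carrier
  ⟦ pos zero ⟧ℤ       = 0#
  ⟦ pos (suc zero) ⟧ℤ = 1#
  ⟦ i ⟧ℤ              = fromℤ i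

  ⟦⟧ℤ≡fromℤ : ∀ i → ⟦ i ⟧ℤ ≡ fromℤ i
  ⟦⟧ℤ≡fromℤ (pos zero)          = refl
  ⟦⟧ℤ≡fromℤ (pos (suc zero))    = sym (+-identityʳ _)
  ⟦⟧ℤ≡fromℤ (pos (suc (suc n))) = refl
  ⟦⟧ℤ≡fromℤ -[1+ n ]            = refl

  private
    almostCommutativeRing : ACR.AlmostCommutativeRing 0ℓ 0ℓ
    almostCommutativeRing = ACR.fromCommutativeRing commutativeRing

    homo₂ : ∀ {f : ℤ → ℤ → ℤ} {g : Carrier → Carrier → Carrier} →
            (∀ i j → fromℤ (f i j) ≡ g (fromℤ i) (fromℤ j)) →
            ∀ i j → ⟦ f i j ⟧ℤ ≡ g ⟦ i ⟧ℤ ⟦ j ⟧ℤ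
    homo₂ {f} {g} hom i j = begin
      ⟦ f i j ⟧ℤ              ≡⟨ ⟦⟧ℤ≡fromℤ (f i j) ⟩
      fromℤ (f i j)           ≡⟨ hom i j ⟩
      g (fromℤ i) (fromℤ j)   ≡⟨ sym (cong₂ g (⟦⟧ℤ≡fromℤ i) (⟦⟧ℤ≡fromℤ j)) ⟩
      g ⟦ i ⟧ℤ ⟦ j ⟧ℤ         ∎

    ℤ⟶F : ℤ.+-*-rawRing ACR.-Raw-AlmostCommutative⟶ almostCommutativeRing
    ℤ⟶F = record
      { ⟦_⟧    = ⟦_⟧ℤ
      ; +-homo = homo₂ {ℤ._+_} {_+_} fromℤ-+
      ; *-homo = homo₂ {ℤ._*_} {_*_} fromℤ-*
      ; -‿homo = λ i → trans (⟦⟧ℤ≡fromℤ (ℤ.- i)) (trans (fromℤ-neg i) (cong -_ (sym (⟦⟧ℤ≡fromℤ i))))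
      ; 0-homo = refl
      ; 1-homo = refl
      }

    ℤ-equal? : ∀ i j → Maybe (⟦ i ⟧ℤ ≡ ⟦ j ⟧ℤ)
    ℤ-equal? i j with i ℤ.≟ j
    ... | yes refl = just refl
    ... | no _     = nothing

  module Solver = Algebra.Solver.Ring ℤ.+-*-rawRing almostCommutativeRing ℤ⟶F ℤ-equal?

  open import Algebra.Properties.Semiring.Exp semiring using (^-homo-*; ^-assocʳ)
    renaming (_^_ to _^ₛ_)
  open import Algebra.Properties.CommutativeSemiring.Exp commutativeSemiring using (^-distrib-*)

  ^≡^ₛ : ∀ a n → a ^ n ≡ a ^ₛ n
  ^≡^ₛ a zero    = refl
  ^≡^ₛ a (suc n) = cong (a *_) (^≡^ₛ a n)

  pow-add : ∀ a i j → a ^ (i ℕ.+ j) ≡ a ^ i * a ^ j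
  pow-add a i j = begin
    a ^ (i ℕ.+ j)      ≡⟨ ^≡^ₛ a (i ℕ.+ j) ⟩
    a ^ₛ (i ℕ.+ j)     ≡⟨ ^-homo-* a i j ⟩
    a ^ₛ i * a ^ₛ j    ≡⟨ sym (cong₂ _*_ (^≡^ₛ a i) (^≡^ₛ a j)) ⟩
    a ^ i * a ^ j      ∎

  pow-mul : ∀ a b n → (a * b) ^ n ≡ a ^ n * b ^ n
  pow-mul a b n = begin
    (a * b) ^ n        ≡⟨ ^≡^ₛ (a * b) n ⟩
    (a * b) ^ₛ n       ≡⟨ ^-distrib-* a b n ⟩
    a ^ₛ n * b ^ₛ n    ≡⟨ sym (cong₂ _*_ (^≡^ₛ a n) (^≡^ₛ b n)) ⟩
    a ^ n * b ^ n      ∎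

  pow-pow : ∀ a i j → (a ^ i) ^ j ≡ a ^ (i ℕ.* j)
  pow-pow a i j = begin
    (a ^ i) ^ j        ≡⟨ ^≡^ₛ (a ^ i) j ⟩
    (a ^ i) ^ₛ j       ≡⟨ cong (_^ₛ j) (^≡^ₛ a i) ⟩
    (a ^ₛ i) ^ₛ j      ≡⟨ ^-assocʳ a i j ⟩
    a ^ₛ (i ℕ.* j)     ≡⟨ sym (^≡^ₛ a (i ℕ.* j)) ⟩
    a ^ (i ℕ.* j)      ∎

  fromℕ-^ : ∀ a n → fromℕ (a ℕ.^ n) ≡ fromℕ a ^ n
  fromℕ-^ a zero    = +-identityʳ _
  fromℕ-^ a (suc n) = trans (fromℕ-* a (a ℕ.^ n)) (cong (fromℕ a *_) (fromℕ-^ a n))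

  one-pow : ∀ n → 1# ^ n ≡ 1#
  one-pow zero    = refl
  one-pow (suc n) = trans (*-identityˡ _) (one-pow n)

module Characteristic (F : Field) where
  open FieldArithmetic F
  open CommutativeRing commutativeRing using (+-commutativeMonoid; +-group)
  open import Algebra.Properties.Group +-group using (identityʳ-unique)
  open import Algebra.Properties.CommutativeMonoid.Sum +-commutativeMonoid
    using (sum; sum-permute; sum-cong-≗; ∑-distrib-+)
  open ≡-Reasoning

  sum-ones : ∀ n → sum {n} (λ _ → 1#) ≡ fromℕ n
  sum-ones zero    = refl
  sum-ones (suc n) = cong (1# +_) (sum-ones n)

  -- Summing all elements of F, listed through the bijection with Fin q,
  -- is invariant under the translation x ↦ x + 1; the difference of the
  -- two sums is q · 1.
  order-annihilates-one : ∀ {q} → Carrier ↔ Fin q → fromℕ q ≡ 0#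
  order-annihilates-one {q} enum = identityʳ-unique (sum elt) (fromℕ q) (sym (begin
      sum elt                             ≡⟨ sum-permute elt translation ⟩
      sum (λ i → elt (idx (elt i + 1#)))  ≡⟨ sum-cong-≗ (λ i → Inverse.strictlyInverseʳ enum (elt i + 1#)) ⟩
      sum (λ i → elt i + 1#)              ≡⟨ ∑-distrib-+ elt (λ _ → 1#) ⟩
      sum elt + sum {q} (λ _ → 1#)        ≡⟨ cong (sum elt +_) (sum-ones q) ⟩
      sum elt + fromℕ q                   ∎))
    where
      elt = Inverse.from enum
      idx = Inverse.to enum

      up down : Carrier → Carrier
      up a   = a + 1#
      down a = a - 1#

      shift-back : ∀ a → up (down a) ≡ a
      shift-back a = trans (+-assoc _ _ _) (trans (cong (a +_) (-‿inverseˡ 1#)) (+-identityʳ a))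

      shift-forth : ∀ a → down (up a) ≡ a
      shift-forth a = trans (+-assoc _ _ _) (trans (cong (a +_) (-‿inverseʳ 1#)) (+-identityʳ a))

      onIndices : ∀ {f g : Carrier → Carrier} → (∀ a → f (g a) ≡ a) → ∀ i → idx (f (elt (idx (g (elt i))))) ≡ i
      onIndices {f} {g} fg i = begin
        idx (f (elt (idx (g (elt i)))))  ≡⟨ cong (idx ∘ f) (Inverse.strictlyInverseʳ enum _) ⟩
        idx (f (g (elt i)))              ≡⟨ cong idx (fg (elt i)) ⟩
        idx (elt i)                      ≡⟨ Inverse.strictlyInverseˡ enum i ⟩
        i                                ∎

      translation : Perm.Permutation q q
      translation = Perm.permutation (λ i → idx (up (elt i))) (λ i → idx (down (elt i)))
        (onIndices {up} {down} shift-back) (onIndices {down} {up} shift-forth)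

  no-zero-divisors : ∀ a b → a * b ≡ 0# → a ≢ 0# → b ≡ 0#
  no-zero-divisors a b ab≡0 a≢0 with inverse a a≢0
  ... | a⁻¹ , aa⁻¹≡1 = begin
    b               ≡⟨ sym (*-identityˡ b) ⟩
    1# * b          ≡⟨ cong (_* b) (trans (sym aa⁻¹≡1) (*-comm _ _)) ⟩
    (a⁻¹ * a) * b   ≡⟨ *-assoc _ _ _ ⟩
    a⁻¹ * (a * b)   ≡⟨ cong (a⁻¹ *_) ab≡0 ⟩
    a⁻¹ * 0#        ≡⟨ zeroʳ _ ⟩
    0#              ∎

  pow≡0⇒≡0 : DecidableEquality Carrier → ∀ a e → a ^ e ≡ 0# → a ≡ 0#
  pow≡0⇒≡0 _≟_ a zero    1≡0 = ⊥-elim (0≢1 (sym 1≡0))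
  pow≡0⇒≡0 _≟_ a (suc e) aaᵉ≡0 with a ≟ 0#
  ... | yes a≡0 = a≡0
  ... | no  a≢0 = pow≡0⇒≡0 _≟_ a e (no-zero-divisors a (a ^ e) aaᵉ≡0 a≢0)

  finite⇒decidable : ∀ {q} → Carrier ↔ Fin q → DecidableEquality Carrier
  finite⇒decidable enum a b with Inverse.to enum a Fin.≟ Inverse.to enum b
  ... | yes ia≡ib = yes (begin
    a                             ≡⟨ sym (Inverse.strictlyInverseʳ enum a) ⟩
    Inverse.from enum (Inverse.to enum a) ≡⟨ cong (Inverse.from enum) ia≡ib ⟩
    Inverse.from enum (Inverse.to enum b) ≡⟨ Inverse.strictlyInverseʳ enum b ⟩
    b                             ∎)
  ... | no ia≢ib = no (λ a≡b → ia≢ib (cong (Inverse.to enum) a≡b))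

  characteristic : ∀ p e → HasOrder F (p ℕ.^ e) → fromℕ p ≡ 0#
  characteristic p e enum = pow≡0⇒≡0 (finite⇒decidable enum) (fromℕ p) e
    (trans (sym (fromℕ-^ p e)) (order-annihilates-one enum))

prime∤factorial : ∀ {p} → Prime p → ∀ n → n < p → ¬ (p ∣ n !)
prime∤factorial {p} p-prime zero    n<p p∣1 =
  ℕP.<⇒≱ (ℕ.nonTrivial⇒n>1 p {{prime⇒nonTrivial p-prime}}) (∣⇒≤ p∣1)
prime∤factorial {p} p-prime (suc n) n<p p∣n! with euclidsLemma (suc n) (n !) p-prime p∣n!
... | inj₁ p∣1+n = ℕP.<⇒≱ n<p (∣⇒≤ p∣1+n)
... | inj₂ p∣n!  = prime∤factorial p-prime n (ℕP.<-trans (ℕP.n<1+n n) n<p) p∣n!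

n∣n! : ∀ n → .{{ℕ.NonZero n}} → n ∣ n !
n∣n! (suc n) = m∣m*n (n !)

-- ... hence p divides (p choose j) for 0 < j < p, since
-- (p choose j) · j! (p-j)! = p! and p divides neither j! nor (p-j)!.
prime∣binomial : ∀ {p} → Prime p → ∀ j → 0 < j → j < p → p ∣ p choose j
prime∣binomial {p} p-prime j 0<j j<p with euclidsLemma (p choose j) (j ! ℕ.* (p ∸ j) !) p-prime p∣product
  where
    instance _ = ℕP._!*_!≢0 j (p ∸ j)
    j≤p = ℕP.<⇒≤ j<p
    binomial-factorials : (p choose j) ℕ.* (j ! ℕ.* (p ∸ j) !) ≡ p !
    binomial-factorials = trans (cong (ℕ._* (j ! ℕ.* (p ∸ j) !)) (nCk≡n!/k![n-k]! j≤p))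
                              (m/n*n≡m (k![n∸k]!∣n! j≤p))
    p∣product = subst (p ∣_) (sym binomial-factorials) (n∣n! p {{prime⇒nonZero p-prime}})
... | inj₁ p∣pCj = p∣pCj
... | inj₂ p∣j![p-j]! with euclidsLemma (j !) ((p ∸ j) !) p-prime p∣j![p-j]!
...   | inj₁ p∣j!     = ⊥-elim (prime∤factorial p-prime j j<p p∣j!)
...   | inj₂ p∣[p-j]! = ⊥-elim (prime∤factorial p-prime (p ∸ j) (ℕP.∸-monoʳ-< 0<j (ℕP.<⇒≤ j<p)) p∣[p-j]!)

-- The Frobenius identity (x + y)^p = x^p + y^p in any commutative
-- semiring of prime characteristic p: by the binomial theorem, all the
-- middle terms carry a binomial coefficient divisible by p.
module Frobenius {a ℓ} (S : CommutativeSemiring a ℓ) where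
  open CommutativeSemiring S renaming (refl to ≈-refl; sym to ≈-sym; trans to ≈-trans)
  open import Algebra.Properties.Semiring.Mult semiring using (_×_; ×-assocˡ; ×-congʳ)
  open import Algebra.Properties.Semiring.Exp semiring using (_^_)
  open import Algebra.Properties.CommutativeSemiring.Binomial S using (theorem; binomialTerm)
  open import Algebra.Properties.Monoid.Sum +-monoid using (sum; sum-init-last; sum-cong-≋; sum-replicate-zero)
  open import Data.Vec.Functional using (replicate)
  open import Relation.Binary.Reasoning.Setoid setoid

  ×-zero : ∀ n → n × 0# ≈ 0#
  ×-zero zero    = ≈-refl
  ×-zero (suc n) = ≈-trans (+-identityˡ _) (×-zero n)

  frobenius : ∀ {p} → Prime p → (∀ x → p × x ≈ 0#) → ∀ x y → (x + y) ^ p ≈ x ^ p + y ^ p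
  frobenius {suc n} p-prime char x y = begin
    (x + y) ^ suc n                        ≈⟨ theorem (suc n) x y ⟩
    term Fin.zero + sum (λ i → term (Fin.suc i))
                                           ≈⟨ +-congˡ (sum-init-last (λ i → term (Fin.suc i))) ⟩
    term Fin.zero + (sum (λ i → term (Fin.suc (inject₁ i))) + term (Fin.fromℕ (suc n)))
                                           ≈⟨ +-cong first-term (+-congʳ (sum-cong-≋ middle-terms)) ⟩
    y ^ suc n + (sum (replicate n 0#) + term (Fin.fromℕ (suc n)))
                                           ≈⟨ +-congˡ (+-cong (sum-replicate-zero n) last-term) ⟩
    y ^ suc n + (0# + x ^ suc n)           ≈⟨ +-congˡ (+-identityˡ _) ⟩
    y ^ suc n + x ^ suc n                  ≈⟨ +-comm _ _ ⟩
    x ^ suc n + y ^ suc n                  ∎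
    where
      p = suc n
      term = binomialTerm x y p

      multiple-vanishes : ∀ c z → p ∣ c → c × z ≈ 0#
      multiple-vanishes c z (divides q ≡.refl) = begin
        (q ℕ.* p) × z   ≈⟨ ≈-sym (×-assocˡ z q p) ⟩
        q × (p × z)     ≈⟨ ×-congʳ q (char z) ⟩
        q × 0#          ≈⟨ ×-zero q ⟩
        0#              ∎

      first-term : term Fin.zero ≈ y ^ p
      first-term = ≈-trans (+-identityʳ _) (*-identityˡ _)

      middle-terms : ∀ (i : Fin n) → term (Fin.suc (inject₁ i)) ≈ 0#
      middle-terms i = multiple-vanishes (p choose suc (toℕ (inject₁ i))) _
        (prime∣binomial p-prime (suc (toℕ (inject₁ i))) (s≤s z≤n) (s≤s i<n))
        where
          i<n : toℕ (inject₁ i) < n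
          i<n = ≡.subst (_< n) (≡.sym (FinP.toℕ-inject₁ i)) (FinP.toℕ<n i)

      last-term : term (Fin.fromℕ p) ≈ x ^ p
      last-term = begin
        (p choose toℕ (Fin.fromℕ p)) × (x ^ toℕ (Fin.fromℕ p) * y ^ (p ∸ toℕ (Fin.fromℕ p)))
          ≡⟨ ≡.cong (λ t → (p choose t) × (x ^ t * y ^ (p ∸ t))) (FinP.toℕ-fromℕ p) ⟩
        (p choose p) × (x ^ p * y ^ (p ∸ p))
          ≡⟨ ≡.cong₂ (λ c e → c × (x ^ p * y ^ e)) (nCn≡1 p) (ℕP.n∸n≡0 p) ⟩
        1 × (x ^ p * 1#)   ≈⟨ +-identityʳ _ ⟩
        x ^ p * 1#         ≈⟨ *-identityʳ _ ⟩
        x ^ p              ∎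

module OddExponents where
  open import Data.Nat using (_+_; _*_; _∸_; _/_; _^_)
  open import Data.Nat.DivMod using (m*n/n≡m)
  open import Data.Nat.Tactic.RingSolver using (solve-∀)

  -- For an odd number p = 2m'+1, every power is odd: pˡ = 2 Eₗ + 1 with
  -- E₀ = 0 and Eₗ₊₁ = Eₗ p + m'.
  halfPred : ℕ → ℕ → ℕ
  halfPred m' zero    = 0
  halfPred m' (suc l) = halfPred m' l * suc (2 * m') + m'

  odd-power : ∀ m' l → suc (2 * m') ^ l ≡ suc (2 * halfPred m' l)
  odd-power m' zero    = refl
  odd-power m' (suc l) = begin
    suc (2 * m') * suc (2 * m') ^ l     ≡⟨ cong (suc (2 * m') *_) (odd-power m' l) ⟩
    suc (2 * m') * suc (2 * E)          ≡⟨ odd-product m' E ⟩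
    suc (2 * (E * suc (2 * m') + m'))   ∎
    where
      open ≡-Reasoning
      E = halfPred m' l
      odd-product : ∀ a b → suc (2 * a) * suc (2 * b) ≡ suc (2 * (b * suc (2 * a) + a))
      odd-product = solve-∀

  half-double : ∀ n → (2 * n) / 2 ≡ n
  half-double n = trans (cong (_/ 2) (ℕP.*-comm 2 n)) (m*n/n≡m n 2)

  half-odd-pair : ∀ A B → (suc (2 * A) + suc (2 * B)) / 2 ≡ suc (A + B)
  half-odd-pair A B = trans (cong (_/ 2) (sum-odd-pair A B)) (half-double (suc (A + B)))
    where
      sum-odd-pair : ∀ A B → suc (2 * A) + suc (2 * B) ≡ 2 * suc (A + B)
      sum-odd-pair = solve-∀

  half-odd-triple-pred : ∀ A B C → ((suc (2 * A) + suc (2 * B) + suc (2 * C)) ∸ 1) / 2 ≡ suc (A + B + C)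
  half-odd-triple-pred A B C = trans (cong (_/ 2) (sum-odd-triple A B C)) (half-double (suc (A + B + C)))
    where
      sum-odd-triple : ∀ A B C → (suc (2 * A) + suc (2 * B) + suc (2 * C)) ∸ 1 ≡ 2 * suc (A + B + C)
      sum-odd-triple A B C = cong (_∸ 1) (three-odd A B C)
        where
          three-odd : ∀ A B C → suc (2 * A) + suc (2 * B) + suc (2 * C) ≡ suc (2 * suc (A + B + C))
          three-odd = solve-∀

open OddExponents

-- The ring F[√Δ], with a + b√Δ represented by the pair (a , b); Δ need
-- not be a non-square.
module QuadraticExtension (F : Field) (Δ : Field.Carrier F) where
  open FieldArithmetic F
  open Solver using (solve; _:=_; _:+_; _:*_; con)
  open import Data.Product using (_×_)

  Pair : Set
  Pair = Carrier × Carrier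

  infixl 6 _⊕_
  infixl 7 _⊗_

  _⊕_ _⊗_ : Pair → Pair → Pair
  (a , b) ⊕ (c , d) = (a + c , b + d)
  (a , b) ⊗ (c , d) = (a * c + Δ * (b * d) , a * d + b * c)

  ι : Carrier → Pair
  ι a = (a , 0#)

  private
    O I : ∀ {n} → Solver.Polynomial n
    O = con (pos 0)
    I = con (pos 1)

  ⊕-assoc : ∀ u v w → (u ⊕ v) ⊕ w ≡ u ⊕ (v ⊕ w)
  ⊕-assoc (a , b) (c , d) (e , f) = cong₂ _,_ (+-assoc a c e) (+-assoc b d f)

  ⊕-comm : ∀ u v → u ⊕ v ≡ v ⊕ u
  ⊕-comm (a , b) (c , d) = cong₂ _,_ (+-comm a c) (+-comm b d)

  ⊕-identityˡ : ∀ u → ι 0# ⊕ u ≡ u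
  ⊕-identityˡ (a , b) = cong₂ _,_ (+-identityˡ a) (+-identityˡ b)

  ⊕-identityʳ : ∀ u → u ⊕ ι 0# ≡ u
  ⊕-identityʳ (a , b) = cong₂ _,_ (+-identityʳ a) (+-identityʳ b)

  ⊗-assoc : ∀ u v w → (u ⊗ v) ⊗ w ≡ u ⊗ (v ⊗ w)
  ⊗-assoc (a , b) (c , d) (e , f) = cong₂ _,_
    (solve 7 (λ a b c d e f D → (a :* c :+ D :* (b :* d)) :* e :+ D :* ((a :* d :+ b :* c) :* f)
                             := a :* (c :* e :+ D :* (d :* f)) :+ D :* (b :* (c :* f :+ d :* e))) refl a b c d e f Δ)
    (solve 7 (λ a b c d e f D → (a :* c :+ D :* (b :* d)) :* f :+ (a :* d :+ b :* c) :* e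
                             := a :* (c :* f :+ d :* e) :+ b :* (c :* e :+ D :* (d :* f))) refl a b c d e f Δ)

  ⊗-comm : ∀ u v → u ⊗ v ≡ v ⊗ u
  ⊗-comm (a , b) (c , d) = cong₂ _,_
    (solve 5 (λ a b c d D → a :* c :+ D :* (b :* d) := c :* a :+ D :* (d :* b)) refl a b c d Δ)
    (solve 4 (λ a b c d → a :* d :+ b :* c := c :* b :+ d :* a) refl a b c d)

  ⊗-identityˡ : ∀ u → ι 1# ⊗ u ≡ u
  ⊗-identityˡ (a , b) = cong₂ _,_
    (solve 3 (λ a b D → I :* a :+ D :* (O :* b) := a) refl a b Δ)
    (solve 2 (λ a b → I :* b :+ O :* a := b) refl a b)

  ⊗-identityʳ : ∀ u → u ⊗ ι 1# ≡ u
  ⊗-identityʳ u = trans (⊗-comm u (ι 1#)) (⊗-identityˡ u)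

  ⊗-distribˡ : ∀ u v w → u ⊗ (v ⊕ w) ≡ u ⊗ v ⊕ u ⊗ w
  ⊗-distribˡ (a , b) (c , d) (e , f) = cong₂ _,_
    (solve 7 (λ a b c d e f D → a :* (c :+ e) :+ D :* (b :* (d :+ f))
                := (a :* c :+ D :* (b :* d)) :+ (a :* e :+ D :* (b :* f))) refl a b c d e f Δ)
    (solve 6 (λ a b c d e f → a :* (d :+ f) :+ b :* (c :+ e)
                := (a :* d :+ b :* c) :+ (a :* f :+ b :* e)) refl a b c d e f)

  ⊗-distribʳ : ∀ u v w → (v ⊕ w) ⊗ u ≡ v ⊗ u ⊕ w ⊗ u
  ⊗-distribʳ u v w = trans (⊗-comm (v ⊕ w) u)
    (trans (⊗-distribˡ u v w) (cong₂ _⊕_ (⊗-comm u v) (⊗-comm u w)))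

  ⊗-zeroˡ : ∀ u → ι 0# ⊗ u ≡ ι 0#
  ⊗-zeroˡ (a , b) = cong₂ _,_
    (solve 3 (λ a b D → O :* a :+ D :* (O :* b) := O) refl a b Δ)
    (solve 2 (λ a b → O :* b :+ O :* a := O) refl a b)

  isCommutativeSemiring : IsCommutativeSemiring _≡_ _⊕_ _⊗_ (ι 0#) (ι 1#)
  isCommutativeSemiring = record
    { isSemiring = record
      { isSemiringWithoutAnnihilatingZero = record
        { +-isCommutativeMonoid = record
          { isMonoid = record
            { isSemigroup = record
              { isMagma = record { isEquivalence = isEquivalence ; ∙-cong = cong₂ _⊕_ }
              ; assoc = ⊕-assoc }
            ; identity = ⊕-identityˡ , ⊕-identityʳ }
          ; comm = ⊕-comm }
        ; *-cong = cong₂ _⊗_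
        ; *-assoc = ⊗-assoc
        ; *-identity = ⊗-identityˡ , ⊗-identityʳ
        ; distrib = ⊗-distribˡ , ⊗-distribʳ }
      ; zero = ⊗-zeroˡ , (λ u → trans (⊗-comm u (ι 0#)) (⊗-zeroˡ u)) }
    ; *-comm = ⊗-comm }

  extension : CommutativeSemiring 0ℓ 0ℓ
  extension = record { isCommutativeSemiring = isCommutativeSemiring }

  open import Algebra.Properties.Semiring.Exp (CommutativeSemiring.semiring extension) public
    using (^-homo-*; ^-assocʳ) renaming (_^_ to _^ₚ_)

  ι-⊗ : ∀ s a b → ι s ⊗ (a , b) ≡ (s * a , s * b)
  ι-⊗ s a b = cong₂ _,_
    (solve 4 (λ s a b D → s :* a :+ D :* (O :* b) := s :* a) refl s a b Δ)
    (solve 3 (λ s a b → s :* b :+ O :* a := s :* b) refl s a b)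

  ι-pow : ∀ a n → ι a ^ₚ n ≡ ι (a ^ n)
  ι-pow a zero    = refl
  ι-pow a (suc n) = trans (cong (ι a ⊗_) (ι-pow a n)) (cong₂ _,_
    (solve 3 (λ a b D → a :* b :+ D :* (O :* O) := a :* b) refl a (a ^ n) Δ)
    (solve 2 (λ a b → a :* O :+ O :* b := O) refl a (a ^ n)))

  pure-pow-odd : ∀ t j → (0# , t) ^ₚ suc (2 ℕ.* j) ≡ (0# , t ^ suc (2 ℕ.* j) * Δ ^ j)
  pure-pow-odd t zero    = cong₂ _,_
    (solve 2 (λ t D → O :* I :+ D :* (t :* O) := O) refl t Δ)
    (solve 1 (λ t → O :* O :+ t :* I := (t :* I) :* I) refl t)
  pure-pow-odd t (suc j) = begin
    (0# , t) ^ₚ suc (2 ℕ.* suc j)              ≡⟨ cong (λ n → (0# , t) ^ₚ suc n) (ℕP.*-suc 2 j) ⟩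
    (0# , t) ⊗ ((0# , t) ⊗ (0# , t) ^ₚ suc n)  ≡⟨ cong (λ u → (0# , t) ⊗ ((0# , t) ⊗ u)) (pure-pow-odd t j) ⟩
    (0# , t) ⊗ ((0# , t) ⊗ (0# , T * Δ ^ j))   ≡⟨ cong₂ _,_
       (solve 4 (λ t T E D → O :* (O :* O :+ D :* (t :* (T :* E))) :+ D :* (t :* (O :* (T :* E) :+ t :* O))
                 := O) refl t T (Δ ^ j) Δ)
       (solve 4 (λ t T E D → O :* (O :* (T :* E) :+ t :* O) :+ t :* (O :* O :+ D :* (t :* (T :* E)))
                 := (t :* (t :* T)) :* (D :* E)) refl t T (Δ ^ j) Δ) ⟩
    (0# , (t * (t * T)) * (Δ * Δ ^ j))         ≡⟨ cong (λ m → (0# , t ^ suc m * Δ ^ suc j)) (sym (ℕP.*-suc 2 j)) ⟩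
    (0# , t ^ suc (2 ℕ.* suc j) * Δ ^ suc j)   ∎
    where
      open ≡-Reasoning
      n = 2 ℕ.* j
      T = t ^ suc n

module OddCharacteristic (F : Field) (m' : ℕ) (p-prime : Prime (suc (2 ℕ.* m')))
       (char : Field.fromℕ F (suc (2 ℕ.* m')) ≡ Field.0# F) where
  open FieldArithmetic F
  open ≡-Reasoning

  p : ℕ
  p = suc (2 ℕ.* m')

  open import Algebra.Properties.Semiring.Mult semiring using () renaming (_×_ to _×ₛ_)
  open import Algebra.Properties.Semiring.Exp semiring using () renaming (_^_ to _^ₛ_)

  ×ₛ≡fromℕ* : ∀ n a → n ×ₛ a ≡ fromℕ n * a
  ×ₛ≡fromℕ* zero    a = sym (zeroˡ a)
  ×ₛ≡fromℕ* (suc n) a = begin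
    a + n ×ₛ a                ≡⟨ cong₂ _+_ (sym (*-identityˡ a)) (×ₛ≡fromℕ* n a) ⟩
    1# * a + fromℕ n * a      ≡⟨ sym (distribʳ _ _ _) ⟩
    (1# + fromℕ n) * a        ∎

  frobenius-field : ∀ a b → (a + b) ^ p ≡ a ^ p + b ^ p
  frobenius-field a b = begin
    (a + b) ^ p          ≡⟨ ^≡^ₛ (a + b) p ⟩
    (a + b) ^ₛ p         ≡⟨ Frobenius.frobenius commutativeSemiring p-prime char-p a b ⟩
    a ^ₛ p + b ^ₛ p      ≡⟨ sym (cong₂ _+_ (^≡^ₛ a p) (^≡^ₛ b p)) ⟩
    a ^ p + b ^ p        ∎
    where
      char-p : ∀ z → p ×ₛ z ≡ 0#
      char-p z = trans (×ₛ≡fromℕ* p z) (trans (cong (_* z) char) (zeroˡ z))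

  -- 1/2 lies in the prime field, so it is fixed by the Frobenius map.
  half-fixed : ∀ h → (1# + 1#) * h ≡ 1# → h ^ p ≡ h
  half-fixed h two-h = begin
    h ^ p                      ≡⟨ sym (*-identityʳ _) ⟩
    h ^ p * 1#                 ≡⟨ cong (h ^ p *_) (sym two-fixed) ⟩
    h ^ p * (two ^ p * h)      ≡⟨ sym (*-assoc _ _ _) ⟩
    (h ^ p * two ^ p) * h      ≡⟨ cong (_* h) (sym (pow-mul h two p)) ⟩
    (h * two) ^ p * h          ≡⟨ cong (λ z → z ^ p * h) (trans (*-comm h two) two-h) ⟩
    1# ^ p * h                 ≡⟨ cong (_* h) (one-pow p) ⟩
    1# * h                     ≡⟨ *-identityˡ h ⟩
    h                          ∎
    where
      two = 1# + 1#
      two-fixed : two ^ p * h ≡ 1#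
      two-fixed = trans (cong (_* h) (trans (frobenius-field 1# 1#) (cong₂ _+_ (one-pow p) (one-pow p)))) two-h

  module _ (Δ : Carrier) where
    open QuadraticExtension F Δ
    open import Algebra.Properties.Semiring.Mult (CommutativeSemiring.semiring extension)
      using () renaming (_×_ to _×ₚ_)

    ×ₚ-componentwise : ∀ n a b → n ×ₚ (a , b) ≡ (fromℕ n * a , fromℕ n * b)
    ×ₚ-componentwise zero    a b = sym (cong₂ _,_ (zeroˡ a) (zeroˡ b))
    ×ₚ-componentwise (suc n) a b = begin
      (a , b) ⊕ n ×ₚ (a , b)                      ≡⟨ cong ((a , b) ⊕_) (×ₚ-componentwise n a b) ⟩
      (a + fromℕ n * a , b + fromℕ n * b)         ≡⟨ cong₂ _,_ (absorb a) (absorb b) ⟩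
      ((1# + fromℕ n) * a , (1# + fromℕ n) * b)   ∎
      where
        absorb : ∀ z → z + fromℕ n * z ≡ (1# + fromℕ n) * z
        absorb z = trans (cong (_+ fromℕ n * z) (sym (*-identityˡ z))) (sym (distribʳ _ _ _))

    frobenius-extension : ∀ u v → (u ⊕ v) ^ₚ p ≡ u ^ₚ p ⊕ v ^ₚ p
    frobenius-extension = Frobenius.frobenius extension p-prime char-p
      where
        char-p : ∀ u → p ×ₚ u ≡ ι 0#
        char-p (a , b) = trans (×ₚ-componentwise p a b)
          (cong₂ _,_ (trans (cong (_* a) char) (zeroˡ a)) (trans (cong (_* b) char) (zeroˡ b)))

    frobenius-pair : ∀ a b → (a , b) ^ₚ p ≡ (a ^ p , b ^ p * Δ ^ m')
    frobenius-pair a b = begin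
      (a , b) ^ₚ p                          ≡⟨ cong (_^ₚ p) (cong₂ _,_ (sym (+-identityʳ a)) (sym (+-identityˡ b))) ⟩
      (ι a ⊕ (0# , b)) ^ₚ p                 ≡⟨ frobenius-extension (ι a) (0# , b) ⟩
      ι a ^ₚ p ⊕ (0# , b) ^ₚ p              ≡⟨ cong₂ _⊕_ (ι-pow a p) (pure-pow-odd b m') ⟩
      (a ^ p + 0# , 0# + b ^ p * Δ ^ m')    ≡⟨ cong₂ _,_ (+-identityʳ _) (+-identityˡ _) ⟩
      (a ^ p , b ^ p * Δ ^ m')              ∎

-- Let 2 be invertible in F, with h = 1/2.  For x ∈ F put Δ = 1 - 4x and
-- Y = (1 + √Δ)/2 ∈ F[√Δ], a root of T² - T + x.  The Dickson value
-- D_{n,k}(1,x) is the image of Yⁿ under the F-linear map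
-- L(a + b√Δ) = (2-k) a + k b, because both sides satisfy the recurrence
-- uₙ₊₂ = uₙ₊₁ - x uₙ with the same initial values.
module DicksonAsPower (F : Field) (k : ℕ) where
  open FieldArithmetic F
  open Solver using (solve; _:=_; _:+_; _:*_; _:-_; con)
  open ≡-Reasoning

  c : Carrier
  c = fromℤ (pos 2 ℤ.- pos k)

  c≡2-k : c ≡ fromℕ 2 - fromℕ k
  c≡2-k = trans (fromℤ-+ (pos 2) (ℤ.- pos k)) (cong (fromℕ 2 +_) (fromℤ-neg (pos k)))

  module AtPoint (h : Carrier) (two-h : (1# + 1#) * h ≡ 1#) (x : Carrier) where
    Δ : Carrier
    Δ = 1# - (fromℕ 4 * x)

    open QuadraticExtension F Δ

    Y : Pair
    Y = (h , h)

    Y-root : Y ⊗ Y ≡ Y ⊕ ι (- x)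
    Y-root = cong₂ _,_
      (begin
        h * h + Δ * (h * h)       ≡⟨ solve 2 (λ h x → h :* h :+ (con (pos 1) :- con (pos 4) :* x) :* (h :* h)
                                               := h :* (two :* h) :- x :* ((two :* h) :* (two :* h))) refl h x ⟩
        (h * t) - (x * (t * t))   ≡⟨ cong (λ s → (h * s) - (x * (s * s))) two-h ⟩
        (h * 1#) - (x * (1# * 1#)) ≡⟨ solve 2 (λ h x → h :* con (pos 1) :- x :* (con (pos 1) :* con (pos 1)) := h :- x) refl h x ⟩
        h - x                     ∎)
      (begin
        h * h + h * h             ≡⟨ solve 1 (λ h → h :* h :+ h :* h := h :* (two :* h)) refl h ⟩
        h * t                     ≡⟨ cong (h *_) two-h ⟩
        h * 1#                    ≡⟨ solve 1 (λ h → h :* con (pos 1) := h :+ con (pos 0)) refl h ⟩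
        h + 0#                    ∎)
      where
        two : ∀ {n} → Solver.Polynomial n
        two = con (pos 1) :+ con (pos 1)
        t = (1# + 1#) * h

    Y-recurrence : ∀ n → Y ^ₚ suc (suc n) ≡ Y ^ₚ suc n ⊕ ι (- x) ⊗ Y ^ₚ n
    Y-recurrence n = begin
      Y ⊗ (Y ⊗ Y ^ₚ n)              ≡⟨ sym (⊗-assoc Y Y (Y ^ₚ n)) ⟩
      (Y ⊗ Y) ⊗ Y ^ₚ n              ≡⟨ cong (_⊗ Y ^ₚ n) Y-root ⟩
      (Y ⊕ ι (- x)) ⊗ Y ^ₚ n        ≡⟨ ⊗-distribʳ (Y ^ₚ n) Y (ι (- x)) ⟩
      Y ⊗ Y ^ₚ n ⊕ ι (- x) ⊗ Y ^ₚ n ∎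

    L : Pair → Carrier
    L (a , b) = c * a + fromℕ k * b

    L-⊕ : ∀ u v → L (u ⊕ v) ≡ L u + L v
    L-⊕ (a , b) (a' , b') =
      solve 6 (λ c k a b a' b' → c :* (a :+ a') :+ k :* (b :+ b') := (c :* a :+ k :* b) :+ (c :* a' :+ k :* b'))
        refl c (fromℕ k) a b a' b'

    L-ι⊗ : ∀ s u → L (ι s ⊗ u) ≡ s * L u
    L-ι⊗ s (a , b) = trans (cong L (ι-⊗ s a b))
      (solve 5 (λ c k s a b → c :* (s :* a) :+ k :* (s :* b) := s :* (c :* a :+ k :* b)) refl c (fromℕ k) s a b)

    dickson-as-power : ∀ n → Dickson F n k x ≡ L (Y ^ₚ n)
    dickson-as-power zero = solve 2 (λ c k → c := c :* con (pos 1) :+ k :* con (pos 0)) refl c (fromℕ k)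
    dickson-as-power (suc zero) = sym (begin
      L (Y ⊗ ι 1#)                 ≡⟨ cong L (⊗-identityʳ Y) ⟩
      c * h + fromℕ k * h          ≡⟨ cong (λ z → z * h + fromℕ k * h) c≡2-k ⟩
      (fromℕ 2 - fromℕ k) * h + fromℕ k * h
                                   ≡⟨ solve 2 (λ k h → (con (pos 2) :- k) :* h :+ k :* h := (con (pos 1) :+ con (pos 1)) :* h) refl (fromℕ k) h ⟩
      (1# + 1#) * h                ≡⟨ two-h ⟩
      1#                           ∎)
    dickson-as-power (suc (suc n)) = begin
      Dickson F (suc n) k x - (x * Dickson F n k x)
        ≡⟨ cong₂ (λ u v → u - (x * v)) (dickson-as-power (suc n)) (dickson-as-power n) ⟩
      L (Y ^ₚ suc n) - (x * L (Y ^ₚ n))        ≡⟨ cong (L (Y ^ₚ suc n) +_) (-‿distribˡ-* x _) ⟩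
      L (Y ^ₚ suc n) + (- x) * L (Y ^ₚ n)      ≡⟨ cong (L (Y ^ₚ suc n) +_) (sym (L-ι⊗ (- x) (Y ^ₚ n))) ⟩
      L (Y ^ₚ suc n) + L (ι (- x) ⊗ Y ^ₚ n)    ≡⟨ sym (L-⊕ (Y ^ₚ suc n) _) ⟩
      L (Y ^ₚ suc n ⊕ ι (- x) ⊗ Y ^ₚ n)        ≡⟨ cong L (sym (Y-recurrence n)) ⟩
      L (Y ^ₚ suc (suc n))                     ∎

-- The closed form of D_{p^l₁+p^l₂+p^l₃,k}(1,x) in odd characteristic p:
-- Y^(pˡ) = (1 + Δ^((pˡ-1)/2) √Δ)/2 by the Frobenius map, and expanding
-- the product of three such factors gives
--   D(x) = (1/8) ((2-k) + R(1 - 4x)),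
-- R being the second polynomial of the theorem.
module ClosedForm (F : Field) (m' : ℕ) (p-prime : Prime (suc (2 ℕ.* m')))
       (char : Field.fromℕ F (suc (2 ℕ.* m')) ≡ Field.0# F)
       (h : Field.Carrier F) (two-h : Field._*_ F (Field._+_ F (Field.1# F) (Field.1# F)) h ≡ Field.1# F)
       (k : ℕ) where
  open FieldArithmetic F
  open OddCharacteristic F m' p-prime char
  open DicksonAsPower F k
  open Solver using (solve; _:=_; _:+_; _:*_; con)
  open ≡-Reasoning

  -- R(z), after substituting A = z^E₁, B = z^E₂, C = z^E₃ for the
  -- powers z^((p^lᵢ - 1)/2).
  rhsCubic : Carrier → Carrier → Carrier → Carrier → Carrier
  rhsCubic z A B C = fromℕ k * (z * (A * B * C)) + c * (z * (A * B) + z * (A * C) + z * (B * C))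
                     + fromℕ k * (A + B + C)

  -- since pˡ = 2Eₗ + 1, the exponents of R are Eᵢ, Eᵢ + Eⱼ + 1 and E₁ + E₂ + E₃ + 1
  rhs-at-odd : ∀ z l₁ l₂ l₃ → RHSPoly F p k l₁ l₂ l₃ z
             ≡ rhsCubic z (z ^ halfPred m' l₁) (z ^ halfPred m' l₂) (z ^ halfPred m' l₃)
  rhs-at-odd z l₁ l₂ l₃
    rewrite odd-power m' l₁ | odd-power m' l₂ | odd-power m' l₃
          | half-odd-triple-pred (halfPred m' l₁) (halfPred m' l₂) (halfPred m' l₃)
          | half-odd-pair (halfPred m' l₁) (halfPred m' l₂)
          | half-odd-pair (halfPred m' l₁) (halfPred m' l₃)
          | half-odd-pair (halfPred m' l₂) (halfPred m' l₃)
          | half-double (halfPred m' l₁) | half-double (halfPred m' l₂) | half-double (halfPred m' l₃)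
          = cong₂ _+_ (cong₂ _+_ (cong (λ t → fromℕ k * (z * t)) (pow-add₃ E₁ E₂ E₃))
                                 (cong (c *_) (cong₂ _+_ (cong₂ _+_ (z*pow-add E₁ E₂) (z*pow-add E₁ E₃)) (z*pow-add E₂ E₃))))
                      refl
    where
      E₁ = halfPred m' l₁
      E₂ = halfPred m' l₂
      E₃ = halfPred m' l₃
      pow-add₃ : ∀ a b d → z ^ (a ℕ.+ b ℕ.+ d) ≡ z ^ a * z ^ b * z ^ d
      pow-add₃ a b d = trans (pow-add z (a ℕ.+ b) d) (cong (_* z ^ d) (pow-add z a b))
      z*pow-add : ∀ a b → z * z ^ (a ℕ.+ b) ≡ z * (z ^ a * z ^ b)
      z*pow-add a b = cong (z *_) (pow-add z a b)

  module _ (x : Carrier) where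
    open AtPoint h two-h x
    open QuadraticExtension F Δ

    -- Y^(pˡ) = (1 + Δ^Eₗ √Δ)/2 with Eₗ = (pˡ-1)/2, by iterating Frobenius
    -- and using that 1/2 is fixed by it
    Y-prime-power : ∀ l → Y ^ₚ (p ℕ.^ l) ≡ (h , h * Δ ^ halfPred m' l)
    Y-prime-power zero    = trans (⊗-identityʳ Y) (cong (h ,_) (sym (*-identityʳ h)))
    Y-prime-power (suc l) = begin
      Y ^ₚ (p ℕ.* p ℕ.^ l)              ≡⟨ cong (Y ^ₚ_) (ℕP.*-comm p (p ℕ.^ l)) ⟩
      Y ^ₚ (p ℕ.^ l ℕ.* p)              ≡⟨ sym (^-assocʳ Y (p ℕ.^ l) p) ⟩
      (Y ^ₚ (p ℕ.^ l)) ^ₚ p             ≡⟨ cong (_^ₚ p) (Y-prime-power l) ⟩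
      (h , h * A) ^ₚ p                  ≡⟨ frobenius-pair Δ h (h * A) ⟩
      (h ^ p , (h * A) ^ p * Δ ^ m')    ≡⟨ cong₂ _,_ (half-fixed h two-h) second ⟩
      (h , h * Δ ^ halfPred m' (suc l)) ∎
      where
        E = halfPred m' l
        A = Δ ^ E
        second : (h * A) ^ p * Δ ^ m' ≡ h * Δ ^ (E ℕ.* p ℕ.+ m')
        second = begin
          (h * A) ^ p * Δ ^ m'          ≡⟨ cong (_* Δ ^ m') (pow-mul h A p) ⟩
          (h ^ p * A ^ p) * Δ ^ m'      ≡⟨ cong (λ z → (z * A ^ p) * Δ ^ m') (half-fixed h two-h) ⟩
          (h * A ^ p) * Δ ^ m'          ≡⟨ *-assoc _ _ _ ⟩
          h * (A ^ p * Δ ^ m')          ≡⟨ cong (λ z → h * (z * Δ ^ m')) (pow-pow Δ E p) ⟩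
          h * (Δ ^ (E ℕ.* p) * Δ ^ m')  ≡⟨ cong (h *_) (sym (pow-add Δ (E ℕ.* p) m')) ⟩
          h * Δ ^ (E ℕ.* p ℕ.+ m')      ∎

    dickson-closed-form : ∀ l₁ l₂ l₃
      → Dickson F (p ℕ.^ l₁ ℕ.+ p ℕ.^ l₂ ℕ.+ p ℕ.^ l₃) k x ≡ h * (h * h) * (c + RHSPoly F p k l₁ l₂ l₃ Δ)
    dickson-closed-form l₁ l₂ l₃ = begin
      Dickson F (a ℕ.+ b ℕ.+ d) k x   ≡⟨ dickson-as-power (a ℕ.+ b ℕ.+ d) ⟩
      L (Y ^ₚ (a ℕ.+ b ℕ.+ d))        ≡⟨ cong L (trans (^-homo-* Y (a ℕ.+ b) d) (cong (_⊗ Y ^ₚ d) (^-homo-* Y a b))) ⟩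
      L (Y ^ₚ a ⊗ Y ^ₚ b ⊗ Y ^ₚ d)    ≡⟨ cong L (cong₂ _⊗_ (cong₂ _⊗_ (Y-prime-power l₁) (Y-prime-power l₂)) (Y-prime-power l₃)) ⟩
      L ((h , h * A) ⊗ (h , h * B) ⊗ (h , h * C))
        ≡⟨ solve 7 (λ h D A B C c k →
             c :* ((h :* h :+ D :* ((h :* A) :* (h :* B))) :* h :+ D :* ((h :* (h :* B) :+ (h :* A) :* h) :* (h :* C)))
             :+ k :* ((h :* h :+ D :* ((h :* A) :* (h :* B))) :* (h :* C) :+ (h :* (h :* B) :+ (h :* A) :* h) :* h)
             := h :* (h :* h) :* (c :+ (k :* (D :* (A :* B :* C)) :+ c :* (D :* (A :* B) :+ D :* (A :* C) :+ D :* (B :* C))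
                                        :+ k :* (A :+ B :+ C))))
             refl h Δ A B C c (fromℕ k) ⟩
      h * (h * h) * (c + rhsCubic Δ A B C)  ≡⟨ cong (λ r → h * (h * h) * (c + r)) (sym (rhs-at-odd Δ l₁ l₂ l₃)) ⟩
      h * (h * h) * (c + RHSPoly F p k l₁ l₂ l₃ Δ) ∎
      where
        a = p ℕ.^ l₁
        b = p ℕ.^ l₂
        d = p ℕ.^ l₃
        A = Δ ^ halfPred m' l₁
        B = Δ ^ halfPred m' l₂
        C = Δ ^ halfPred m' l₃

invertible⇒bijective : ∀ {A : Set} (f f⁻¹ : A → A) → (∀ y → f (f⁻¹ y) ≡ y) → (∀ x → f⁻¹ (f x) ≡ x)
                     → Bijective _≡_ _≡_ f
invertible⇒bijective f f⁻¹ ff⁻¹ f⁻¹f = Bijection.bijective (↔⇒⤖ (mk↔ₛ′ f f⁻¹ ff⁻¹ f⁻¹f))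

module _ {A : Set} {D R f g : A → A} (f-bij : Bijective _≡_ _≡_ f) (g-bij : Bijective _≡_ _≡_ g)
         (D≗gRf : ∀ z → D z ≡ g (R (f z))) where

  private
    preimage : ∀ {h : A → A} → Bijective _≡_ _≡_ h → ∀ y → ∃ λ x → h x ≡ y
    preimage (_ , surj) = surjective⇒strictlySurjective surj

    f-inj = f-bij .proj₁
    g-inj = g-bij .proj₁

  conjugate-bijective : Bijective _≡_ _≡_ D ⇔ Bijective _≡_ _≡_ R
  conjugate-bijective = mk⇔ to from
    where
      to : Bijective _≡_ _≡_ D → Bijective _≡_ _≡_ R
      to D-bij@(D-inj , _) = R-inj , strictlySurjective⇒surjective R-onto
        where
          R-inj : ∀ {a b} → R a ≡ R b → a ≡ b
          R-inj {a} {b} Ra≡Rb with preimage f-bij a | preimage f-bij b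
          ... | a' , refl | b' , refl =
            cong f (D-inj (trans (D≗gRf a') (trans (cong g Ra≡Rb) (sym (D≗gRf b')))))
          R-onto : ∀ y → ∃ λ x → R x ≡ y
          R-onto y with preimage D-bij (g y)
          ... | x , Dx≡gy = f x , g-inj (trans (sym (D≗gRf x)) Dx≡gy)

      from : Bijective _≡_ _≡_ R → Bijective _≡_ _≡_ D
      from (R-inj , R-surj) = D-inj , strictlySurjective⇒surjective D-onto
        where
          D-inj : ∀ {a b} → D a ≡ D b → a ≡ b
          D-inj {a} {b} Da≡Db = f-inj (R-inj (g-inj (trans (sym (D≗gRf a)) (trans Da≡Db (D≗gRf b)))))
          D-onto : ∀ y → ∃ λ x → D x ≡ y
          D-onto y with preimage g-bij y
          ... | t , refl with surjective⇒strictlySurjective R-surj t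
          ... | s , refl with preimage f-bij s
          ... | x , refl = x , D≗gRf x

module Affine (F : Field) where
  open FieldArithmetic F
  open Solver using (solve; _:=_; _:+_; _:*_; :-_; con)
  open ≡-Reasoning

  affine : Carrier → Carrier → Carrier → Carrier
  affine a b t = a * t + b

  affine-bijective : ∀ a a⁻¹ b → a * a⁻¹ ≡ 1# → Bijective _≡_ _≡_ (affine a b)
  affine-bijective a a⁻¹ b aa⁻¹≡1 = invertible⇒bijective (affine a b) undo undo-right undo-left
    where
      undo : Carrier → Carrier
      undo t = a⁻¹ * (t + - b)

      undo-right : ∀ t → affine a b (undo t) ≡ t
      undo-right t = begin
        a * (a⁻¹ * (t + - b)) + b    ≡⟨ solve 4 (λ a a' b t → a :* (a' :* (t :+ :- b)) :+ b := (a :* a') :* (t :+ :- b) :+ b) refl a a⁻¹ b t ⟩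
        (a * a⁻¹) * (t + - b) + b    ≡⟨ cong (λ s → s * (t + - b) + b) aa⁻¹≡1 ⟩
        1# * (t + - b) + b           ≡⟨ solve 2 (λ b t → con (pos 1) :* (t :+ :- b) :+ b := t) refl b t ⟩
        t                            ∎

      undo-left : ∀ t → undo (affine a b t) ≡ t
      undo-left t = begin
        a⁻¹ * ((a * t + b) + - b)    ≡⟨ solve 4 (λ a a' b t → a' :* ((a :* t :+ b) :+ :- b) := (a :* a') :* t) refl a a⁻¹ b t ⟩
        (a * a⁻¹) * t                ≡⟨ cong (_* t) aa⁻¹≡1 ⟩
        1# * t                       ≡⟨ *-identityˡ t ⟩
        t                            ∎

parity : ∀ n → ∃ λ j → n ≡ 2 ℕ.* j ⊎ n ≡ suc (2 ℕ.* j)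
parity zero          = 0 , inj₁ refl
parity (suc zero)    = 0 , inj₂ refl
parity (suc (suc n)) with parity n
... | j , inj₁ refl = suc j , inj₁ (sym (ℕP.*-suc 2 j))
... | j , inj₂ refl = suc j , inj₂ (cong suc (sym (ℕP.*-suc 2 j)))

odd-prime : ∀ {p} → Prime p → 2 < p → ∃ λ m' → p ≡ suc (2 ℕ.* m')
odd-prime {p} p-prime 2<p with parity p
... | m' , inj₂ p-odd = m' , p-odd
... | j  , inj₁ p≡2j with prime⇒irreducible p-prime (divides j (trans p≡2j (ℕP.*-comm 2 j)))
...   | inj₁ ()
...   | inj₂ 2≡p = contradiction (subst (2 <_) (sym 2≡p) 2<p) (ℕP.<-irrefl refl)

two≢0 : (F : Field) (m' : ℕ) → Field.fromℕ F (suc (2 ℕ.* m')) ≡ Field.0# F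
      → Field._+_ F (Field.1# F) (Field.1# F) ≢ Field.0# F
two≢0 F m' char two≡0 = 0≢1 (begin
    0#                               ≡⟨ sym char ⟩
    1# + fromℕ (2 ℕ.* m')            ≡⟨ cong (1# +_) (fromℕ-* 2 m') ⟩
    1# + fromℕ 2 * fromℕ m'          ≡⟨ cong (λ t → 1# + t * fromℕ m') (trans (cong (1# +_) (+-identityʳ 1#)) two≡0) ⟩
    1# + 0# * fromℕ m'               ≡⟨ cong (1# +_) (zeroˡ _) ⟩
    1# + 0#                          ≡⟨ +-identityʳ 1# ⟩
    1#                               ∎)
  where
    open FieldArithmetic F
    open ≡-Reasoning

module Conjugation (F : Field) (m' : ℕ) (p-prime : Prime (suc (2 ℕ.* m')))
       (char : Field.fromℕ F (suc (2 ℕ.* m')) ≡ Field.0# F)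
       (h : Field.Carrier F) (two-h : Field._*_ F (Field._+_ F (Field.1# F) (Field.1# F)) h ≡ Field.1# F)
       (k : ℕ) where
  open FieldArithmetic F
  open OddCharacteristic F m' p-prime char using (p)
  open DicksonAsPower F k using (c)
  open ClosedForm F m' p-prime char h two-h k
  open Affine F
  open Solver using (solve; _:=_; _:+_; _:*_; :-_; con)
  open ≡-Reasoning

  h³ : Carrier
  h³ = h * (h * h)

  dickson-conjugate : ∀ l₁ l₂ l₃ x → Dickson F (p ℕ.^ l₁ ℕ.+ p ℕ.^ l₂ ℕ.+ p ℕ.^ l₃) k x
                    ≡ affine h³ (h³ * c) (RHSPoly F p k l₁ l₂ l₃ (affine (- fromℕ 4) 1# x))
  dickson-conjugate l₁ l₂ l₃ x = begin
    Dickson F (p ℕ.^ l₁ ℕ.+ p ℕ.^ l₂ ℕ.+ p ℕ.^ l₃) k x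
      ≡⟨ dickson-closed-form x l₁ l₂ l₃ ⟩
    h³ * (c + R (1# - (fromℕ 4 * x)))
      ≡⟨ cong (λ z → h³ * (c + R z)) (solve 1 (λ x → con (pos 1) :+ :- (con (pos 4) :* x) := :- con (pos 4) :* x :+ con (pos 1)) refl x) ⟩
    h³ * (c + R (affine (- fromℕ 4) 1# x))
      ≡⟨ solve 3 (λ a c r → a :* (c :+ r) := a :* r :+ a :* c) refl h³ c (R (affine (- fromℕ 4) 1# x)) ⟩
    affine h³ (h³ * c) (R (affine (- fromℕ 4) 1# x)) ∎
    where R = RHSPoly F p k l₁ l₂ l₃

  -- (-4)(-h²) = (2h)² = 1 and h³ · 8 = (2h)³ = 1
  minus-four-inverse : (- fromℕ 4) * (- (h * h)) ≡ 1#
  minus-four-inverse = begin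
    (- fromℕ 4) * (- (h * h))    ≡⟨ solve 1 (λ h → :- con (pos 4) :* :- (h :* h) := (two :* h) :* (two :* h)) refl h ⟩
    ((1# + 1#) * h) * ((1# + 1#) * h)  ≡⟨ cong₂ _*_ two-h two-h ⟩
    1# * 1#                      ≡⟨ *-identityˡ 1# ⟩
    1#                           ∎
    where
      two : ∀ {n} → Solver.Polynomial n
      two = con (pos 1) :+ con (pos 1)

  eight-inverse : h³ * fromℕ 8 ≡ 1#
  eight-inverse = begin
    h³ * fromℕ 8                 ≡⟨ solve 1 (λ h → h :* (h :* h) :* con (pos 8) := (two :* h) :* ((two :* h) :* (two :* h))) refl h ⟩
    ((1# + 1#) * h) * (((1# + 1#) * h) * ((1# + 1#) * h))  ≡⟨ cong₂ _*_ two-h (cong₂ _*_ two-h two-h) ⟩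
    1# * (1# * 1#)               ≡⟨ trans (*-identityˡ _) (*-identityˡ 1#) ⟩
    1#                           ∎
    where
      two : ∀ {n} → Solver.Polynomial n
      two = con (pos 1) :+ con (pos 1)

  dickson⇔rhs : ∀ l₁ l₂ l₃ → IsPermutation F (Dickson F (p ℕ.^ l₁ ℕ.+ p ℕ.^ l₂ ℕ.+ p ℕ.^ l₃) k)
                            ⇔ IsPermutation F (RHSPoly F p k l₁ l₂ l₃)
  dickson⇔rhs l₁ l₂ l₃ = conjugate-bijective
    (affine-bijective (- fromℕ 4) (- (h * h)) 1# minus-four-inverse)
    (affine-bijective h³ (fromℕ 8) (h³ * c) eight-inverse)
    (dickson-conjugate l₁ l₂ l₃)

-- The theorem.
open import Data.Nat using (_≤_; _^_; _+_)
open import Data.Integer using (+_) renaming (_*_ to _*ℤ_; _-_ to _-ℤ_)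

mainTheorem15 : (p k e l₁ l₂ l₃ : ℕ) → Prime p → 3 < p → k ≤ p ∸ 1 → k ≢ 3 → 1 ≤ e
    → QNRQuot p (+ 3 *ℤ + k) (+ 2 *ℤ (+ k -ℤ + 3))
    → (F : Field) → HasOrder F (p ^ e)
    → IsPermutation F (Dickson F (p ^ l₁ + p ^ l₂ + p ^ l₃) k)
      ⇔ IsPermutation F (RHSPoly F p k l₁ l₂ l₃)
mainTheorem15 p k e l₁ l₂ l₃ p-prime 3<p _ _ _ _ F order
  with odd-prime p-prime (ℕP.<-trans (ℕP.n<1+n 2) 3<p)
... | m' , refl = Conjugation.dickson⇔rhs F m' p-prime char h two-h k l₁ l₂ l₃
  where
    char = Characteristic.characteristic F p e order
    half = Field.inverse F _ (two≢0 F m' char)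
    h = half .proj₁
    two-h = half .proj₂
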